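{- $(2^\omega,\mathbb{B}_0)\not\sqsubseteq_c(2^\omega,G_{s(\mathbb{G}_0)})$.
   Context: $(X,A)\sqsubseteq_c(Y,B)$ means there is an injective continuous $f:X\to Y$ with $(f(x),f(y))\in B\iff(x,y)\in A$ for all $x,y$. Let $\psi:\omega\to2^{<\omega}$ list finite binary sequences by increasing length and lexicographically within each length, $s_n:=\psi(n)0^{n-|\psi(n)|}$, $\mathbb{G}_0:=\{(s_n0\gamma,s_n1\gamma)\mid n\in\omega,\gamma\in2^\omega\}$, $s(\mathbb{G}_0):=\mathbb{G}_0\cup\mathbb{G}_0^{ -1}$, $\mathbb{B}_0:=\{(0\alpha,1\beta)\mid(\alpha,\beta)\in\mathbb{G}_0\}$ and $G_{s(\mathbb{G}_0)}:=\{(0\alpha,1\beta)\mid(\alpha,\beta)\in s(\mathbb{G}_0)\}$, both relations on $2^\omega$. -}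

module Defs where

open import Data.Bool using (Bool; true; false)
open import Data.Nat using (ℕ; zero; suc; _∸_; _<_)
open import Data.List using (List; []; _∷_; _++_; reverse; replicate; length)
open import Data.Product using (Σ; _×_; ∃; ∃-syntax; _,_)
open import Data.Sum using (_⊎_)
open import Relation.Binary.PropositionalEquality using (_≡_)

Cantor : Set
Cantor = ℕ → Bool

_≈_ : Cantor → Cantor → Set
x ≈ y = ∀ i → x i ≡ y i

infixr 5 _⊕_
_⊕_ : List Bool → Cantor → Cantor
([] ⊕ x) i = x i
((b ∷ s) ⊕ x) zero = b
((b ∷ s) ⊕ x) (suc i) = (s ⊕ x) i

Rel₂ : Set₁
Rel₂ = Cantor → Cantor → Set

-- successor of a binary sequence in the order "by length, then lexicographic",
-- on sequences stored least-significant (= last) digit first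
incr : List Bool → List Bool
incr [] = false ∷ []
incr (false ∷ xs) = true ∷ xs
incr (true ∷ xs) = false ∷ incr xs

ψrev : ℕ → List Bool
ψrev zero = []
ψrev (suc n) = incr (ψrev n)

-- ψ : ω → 2^{<ω}, enumeration by increasing length, lexicographic within each length
ψ : ℕ → List Bool
ψ n = reverse (ψrev n)

s : ℕ → List Bool
s n = ψ n ++ replicate (n ∸ length (ψ n)) false

G₀ : Rel₂
G₀ x y = ∃[ n ] ∃[ γ ] (x ≈ (s n ⊕ ((false ∷ []) ⊕ γ)) × y ≈ (s n ⊕ ((true ∷ []) ⊕ γ)))

sG₀ : Rel₂
sG₀ x y = G₀ x y ⊎ G₀ y x

B₀ : Rel₂
B₀ x y = ∃[ α ] ∃[ β ] (G₀ α β × x ≈ ((false ∷ []) ⊕ α) × y ≈ ((true ∷ []) ⊕ β))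

GsG₀ : Rel₂
GsG₀ x y = ∃[ α ] ∃[ β ] (sG₀ α β × x ≈ ((false ∷ []) ⊕ α) × y ≈ ((true ∷ []) ⊕ β))

Continuous : (Cantor → Cantor) → Set
Continuous f = ∀ x n → ∃[ m ] (∀ y → (∀ i → i < m → x i ≡ y i) → ∀ i → i < n → f x i ≡ f y i)

Injective : (Cantor → Cantor) → Set
Injective f = ∀ x y → f x ≈ f y → x ≈ y

_⊑c_ : Rel₂ → Rel₂ → Set
A ⊑c B = Σ (Cantor → Cantor) λ f → Continuous f × Injective f ×
           (∀ x y → (B (f x) (f y) → A x y) × (A x y → B (f x) (f y)))

module Submission where

-- Suppose f : 2^ω → 2^ω is a continuous injective reduction of
-- 𝔹₀ to G_{s(𝔾₀)}.  Call z a cluster point if it has 𝔾₀-neighbours w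
-- arbitrarily close to it.  For such z, every close neighbour w gives an
-- edge (0z, 1w) of 𝔹₀, hence an edge (f(0z), f(1w)) of G_{s(𝔾₀)}: the tails
-- of f(0z) and f(1w) differ in exactly one digit.  If the tails of f(0z) and
-- f(1z) differed at digit i, continuity would force that digit to be i for
-- all close w, so f(1w) would not depend on w, contradicting injectivity.
-- Hence f(0z) and f(1z) have equal tails and (by injectivity) distinct heads.
-- Every point h0^ω is a cluster point (because ψ is onto 2^{<ω}), in
-- particular 0^ω and 10^ω, which form an edge of 𝔾₀.  Transporting the image
-- of the edge (0·0^ω, 1·10^ω) along these tail equalities yields an edge
-- (f(0·10^ω), f(1·0^ω)) of G_{s(𝔾₀)}, hence the impossible 𝔾₀-edge from
-- 10^ω to 0^ω.

open import Defs
open import Relation.Nullary using (¬_; yes; no)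
open import Data.Bool using (Bool; true; false; not)
import Data.Bool.Properties as Bool
open import Data.Nat using (ℕ; zero; suc; _+_; _∸_; _<_; _≤_; s≤s)
open import Data.Nat.Properties using (_≟_; +-suc; ≤-refl; <-≤-trans; <-trans; n<1+n; m≤m+n; m≤n+m)
open import Data.List using (List; []; _∷_; _++_; reverse; replicate; length)
open import Data.List.Properties using (length-++; length-replicate; reverse-involutive)
open import Data.Product using (_×_; ∃-syntax; _,_; proj₁; proj₂)
open import Data.Sum using (inj₁; inj₂)
open import Data.Empty using (⊥; ⊥-elim)
open import Relation.Binary.PropositionalEquality

push : Bool → Cantor → Cantor
push b x = (b ∷ []) ⊕ x

tail : Cantor → Cantor
tail x i = x (suc i)

zeros : Cantor
zeros _ = false

AgreeBelow : ℕ → Cantor → Cantor → Set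
AgreeBelow m x y = ∀ i → i < m → x i ≡ y i

≈-sym : ∀ {x y} → x ≈ y → y ≈ x
≈-sym e i = sym (e i)

agree-push : ∀ {m x y} b → AgreeBelow m x y → AgreeBelow m (push b x) (push b y)
agree-push b a zero _ = refl
agree-push b a (suc i) i<m = a i (<-trans (n<1+n i) i<m)

⊕-cong : ∀ t {x y} → x ≈ y → (t ⊕ x) ≈ (t ⊕ y)
⊕-cong [] e i = e i
⊕-cong (b ∷ t) e zero = refl
⊕-cong (b ∷ t) e (suc i) = ⊕-cong t e i

⊕-++ : ∀ t u x → ((t ++ u) ⊕ x) ≈ (t ⊕ (u ⊕ x))
⊕-++ [] u x i = refl
⊕-++ (b ∷ t) u x zero = refl
⊕-++ (b ∷ t) u x (suc i) = ⊕-++ t u x i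

⊕-agree : ∀ t x y → AgreeBelow (length t) (t ⊕ x) (t ⊕ y)
⊕-agree (b ∷ t) x y zero _ = refl
⊕-agree (b ∷ t) x y (suc i) (s≤s i<t) = ⊕-agree t x y i i<t

⊕-at-length : ∀ t b γ → (t ⊕ push b γ) (length t) ≡ b
⊕-at-length [] b γ = refl
⊕-at-length (_ ∷ t) b γ = ⊕-at-length t b γ

⊕-off-length : ∀ t b c γ j → j ≢ length t → (t ⊕ push b γ) j ≡ (t ⊕ push c γ) j
⊕-off-length [] b c γ zero j≢0 = ⊥-elim (j≢0 refl)
⊕-off-length [] b c γ (suc j) _ = refl
⊕-off-length (_ ∷ t) b c γ zero _ = refl
⊕-off-length (_ ∷ t) b c γ (suc j) j≢ = ⊕-off-length t b c γ j (λ e → j≢ (cong suc e))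

zeros-pad : ∀ k {x} → x ≈ zeros → (replicate k false ⊕ x) ≈ zeros
zeros-pad zero e i = e i
zeros-pad (suc k) e zero = refl
zeros-pad (suc k) e (suc i) = zeros-pad k e i

-- ψrev n is the bijective base-2 numeral of n, least significant digit first
-- (digits false = 1, true = 2).  Its value map `code` is a right inverse, so
-- ψ is onto 2^{<ω}.

code : List Bool → ℕ
code [] = 0
code (false ∷ l) = suc (code l + code l)
code (true ∷ l) = suc (suc (code l + code l))

ψrev-odd : ∀ v → ψrev (suc (v + v)) ≡ false ∷ ψrev v
ψrev-odd zero = refl
ψrev-odd (suc v) rewrite +-suc v v = cong (λ l → incr (incr l)) (ψrev-odd v)

ψrev-code : ∀ l → ψrev (code l) ≡ l
ψrev-code [] = refl
ψrev-code (false ∷ l) = trans (ψrev-odd (code l)) (cong (false ∷_) (ψrev-code l))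
ψrev-code (true ∷ l) = cong incr (trans (ψrev-odd (code l)) (cong (false ∷_) (ψrev-code l)))

ψ-surjective : ∀ t → ∃[ n ] ψ n ≡ t
ψ-surjective t = code (reverse t) ,
  trans (cong reverse (ψrev-code (reverse t))) (reverse-involutive t)

G₀-flip : ∀ {a b} → G₀ a b →
  ∃[ p ] (a p ≡ false × b p ≡ true × (∀ j → j ≢ p → a j ≡ b j))
G₀-flip (n , γ , ea , eb) =
  length (s n) ,
  trans (ea _) (⊕-at-length (s n) false γ) ,
  trans (eb _) (⊕-at-length (s n) true γ) ,
  λ j j≢ → trans (ea j) (trans (⊕-off-length (s n) false true γ j j≢) (sym (eb j)))

G₀-target-nonzero : ∀ {a b} → G₀ a b → ¬ b ≈ zeros
G₀-target-nonzero g b≈0 with G₀-flip g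
... | p , _ , bp , _ with trans (sym bp) (b≈0 p)
... | ()

sG₀-flip : ∀ {a b} → sG₀ a b → ∃[ p ] (∀ j → j ≢ p → a j ≡ b j)
sG₀-flip (inj₁ g) with G₀-flip g
... | p , _ , _ , off = p , off
sG₀-flip (inj₂ g) with G₀-flip g
... | p , _ , _ , off = p , λ j j≢ → sym (off j j≢)

G₀-resp : ∀ {a a' b b'} → a ≈ a' → b ≈ b' → G₀ a b → G₀ a' b'
G₀-resp ea eb (n , γ , e₁ , e₂) =
  n , γ , (λ i → trans (sym (ea i)) (e₁ i)) , (λ i → trans (sym (eb i)) (e₂ i))

sG₀-resp : ∀ {a a' b b'} → a ≈ a' → b ≈ b' → sG₀ a b → sG₀ a' b'
sG₀-resp ea eb (inj₁ g) = inj₁ (G₀-resp ea eb g)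
sG₀-resp ea eb (inj₂ g) = inj₂ (G₀-resp eb ea g)

sG₀-sym : ∀ {a b} → sG₀ a b → sG₀ b a
sG₀-sym (inj₁ g) = inj₂ g
sG₀-sym (inj₂ g) = inj₁ g

B₀-intro : ∀ {a b} → G₀ a b → B₀ (push false a) (push true b)
B₀-intro g = _ , _ , g , (λ _ → refl) , (λ _ → refl)

B₀-elim : ∀ {x y} → B₀ x y → G₀ (tail x) (tail y)
B₀-elim (α , β , g , ex , ey) =
  G₀-resp (λ i → sym (ex (suc i))) (λ i → sym (ey (suc i))) g

GsG₀-intro : ∀ {x y} → x 0 ≡ false → y 0 ≡ true → sG₀ (tail x) (tail y) → GsG₀ x y
GsG₀-intro x₀ y₀ e =
  _ , _ , e , (λ { zero → x₀ ; (suc i) → refl }) , (λ { zero → y₀ ; (suc i) → refl })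

GsG₀-elim : ∀ {x y} → GsG₀ x y → x 0 ≡ false × y 0 ≡ true × sG₀ (tail x) (tail y)
GsG₀-elim (α , β , e , ex , ey) =
  ex 0 , ey 0 , sG₀-resp (λ i → sym (ex (suc i))) (λ i → sym (ey (suc i))) e

ClusterPoint : Cantor → Set
ClusterPoint z = ∀ m → ∃[ w ] (G₀ z w × AgreeBelow m z w)

-- A cluster point even has two distinct neighbours arbitrarily close to it:
-- a second neighbour close enough agrees with z at the digit the first flips.
distinct-neighbours : ∀ {z} → ClusterPoint z → ∀ m →
  ∃[ w ] ∃[ w' ] (G₀ z w × G₀ z w' × AgreeBelow m z w × AgreeBelow m z w' × ¬ w ≈ w')
distinct-neighbours {z} cp m with cp m
... | w , g , a with G₀-flip g
... | p , zp , wp , _ with cp (suc p + m)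
... | w' , g' , a' =
  w , w' , g , g' , a , (λ i i<m → a' i (<-≤-trans i<m (m≤n+m m (suc p)))) ,
  λ w≈w' → true≢false (trans (sym wp) (trans (w≈w' p) (trans (sym (a' p p<)) zp)))
  where
  p< : p < suc p + m
  p< = s≤s (m≤m+n p m)
  true≢false : true ≢ false
  true≢false ()

-- Every sequence h0^ω is a cluster point: choose n with ψ(n) = h0^m; then
-- s_n = h0^{m+k}, and s_n 1 0^ω is a 𝔾₀-neighbour agreeing on |h| + m digits.
cluster-point : ∀ h → ClusterPoint (h ⊕ zeros)
cluster-point h m with ψ-surjective (h ++ replicate m false)
... | n , ψn≡t = s n ⊕ push true zeros , g , close
  where
  t = h ++ replicate m false
  k = n ∸ length (ψ n)

  s-shape : s n ≡ t ++ replicate k false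
  s-shape = cong (_++ replicate k false) ψn≡t

  via-t : ∀ x → (s n ⊕ x) ≈ (t ⊕ (replicate k false ⊕ x))
  via-t x i = trans (cong (λ u → (u ⊕ x) i) s-shape) (⊕-++ t (replicate k false) x i)

  z-shape : (h ⊕ zeros) ≈ (t ⊕ (replicate k false ⊕ push false zeros))
  z-shape i = begin
    (h ⊕ zeros) i
      ≡⟨ ⊕-cong h (≈-sym (zeros-pad m (zeros-pad k (zeros-pad 1 λ _ → refl)))) i ⟩
    (h ⊕ (replicate m false ⊕ (replicate k false ⊕ push false zeros))) i
      ≡⟨ sym (⊕-++ h (replicate m false) _ i) ⟩
    (t ⊕ (replicate k false ⊕ push false zeros)) i ∎
    where open ≡-Reasoning

  g : G₀ (h ⊕ zeros) (s n ⊕ push true zeros)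
  g = n , zeros , (λ i → trans (z-shape i) (sym (via-t _ i))) , (λ _ → refl)

  m≤|t| : m ≤ length t
  m≤|t| = subst (m ≤_)
    (sym (trans (length-++ h) (cong (length h +_) (length-replicate m))))
    (m≤n+m m (length h))

  close : AgreeBelow m (h ⊕ zeros) (s n ⊕ push true zeros)
  close i i<m = trans (z-shape i)
    (trans (⊕-agree t _ _ i (<-≤-trans i<m m≤|t|)) (sym (via-t _ i)))

module Reduction (f : Cantor → Cantor) (continuous : Continuous f) (injective : Injective f)
  (reflect : ∀ x y → GsG₀ (f x) (f y) → B₀ x y)
  (preserve : ∀ x y → B₀ x y → GsG₀ (f x) (f y)) where

  -- If the tails of f(0z) and f(1z) differ at digit i, then on a
  -- neighbourhood of z (given by continuity at 1z) every 𝔾₀-neighbour w has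
  -- f(1w) equal to one fixed sequence: head 1, digit i taken from f(1z), all
  -- other digits from f(0z).
  module Forced (z : Cantor) (i : ℕ) (differ : f (push false z) (suc i) ≢ f (push true z) (suc i)) where

    radius : ℕ
    radius = proj₁ (continuous (push true z) (suc (suc i)))

    near : ∀ {w} → AgreeBelow radius z w → f (push true w) (suc i) ≡ f (push true z) (suc i)
    near a = sym (proj₂ (continuous (push true z) (suc (suc i))) _ (agree-push true a) (suc i) ≤-refl)

    predicted : Cantor
    predicted zero = true
    predicted (suc j) with j ≟ i
    ... | yes _ = f (push true z) (suc i)
    ... | no _ = f (push false z) (suc j)

    forced : ∀ {w} → G₀ z w → AgreeBelow radius z w → f (push true w) ≈ predicted
    forced {w} g a with GsG₀-elim (preserve _ _ (B₀-intro g))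
    ... | _ , head , edge with sG₀-flip edge
    ... | p , off = at
      where
      flip-at-i : i ≡ p
      flip-at-i with i ≟ p
      ... | yes i≡p = i≡p
      ... | no i≢p = ⊥-elim (differ (trans (off i i≢p) (near a)))

      at : f (push true w) ≈ predicted
      at zero = head
      at (suc j) with j ≟ i
      ... | yes refl = near a
      ... | no j≢i = sym (off j (λ j≡p → j≢i (trans j≡p (sym flip-at-i))))

    -- Two distinct close neighbours of a cluster point z would have equal
    -- images, which injectivity forbids.
    impossible : ClusterPoint z → ⊥
    impossible cp with distinct-neighbours cp radius
    ... | w , w' , g , g' , a , a' , w≉w' =
      w≉w' λ j → injective (push true w) (push true w')
        (λ k → trans (forced g a k) (sym (forced g' a' k))) (suc j)

  tails-agree : ∀ {z} → ClusterPoint z → tail (f (push false z)) ≈ tail (f (push true z))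
  tails-agree {z} cp i with f (push false z) (suc i) Bool.≟ f (push true z) (suc i)
  ... | yes same = same
  ... | no differ = ⊥-elim (Forced.impossible z i differ cp)

  heads-differ : ∀ {z} → ClusterPoint z → f (push false z) 0 ≢ f (push true z) 0
  heads-differ cp same with injective _ _ (λ { zero → same ; (suc j) → tails-agree cp j }) zero
  ... | ()

  z₁ z₂ : Cantor
  z₁ = [] ⊕ zeros
  z₂ = push true zeros

  cp₁ : ClusterPoint z₁
  cp₁ = cluster-point []

  cp₂ : ClusterPoint z₂
  cp₂ = cluster-point (true ∷ [])

  edge : G₀ z₁ z₂
  edge = 0 , zeros , (λ { zero → refl ; (suc i) → refl }) , (λ _ → refl)

  -- Swapping the tails of f(0z₁) and f(1z₂) by tails-agree, and fixing the
  -- heads by heads-differ, turns the image of the edge into the reversed edge.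
  reversed-edge : GsG₀ (f (push false z₂)) (f (push true z₁))
  reversed-edge with GsG₀-elim (preserve _ _ (B₀-intro edge))
  ... | head₁ , head₂ , e = GsG₀-intro
    (trans (Bool.¬-not (heads-differ cp₂)) (cong not head₂))
    (trans (Bool.¬-not (λ same → heads-differ cp₁ (sym same))) (cong not head₁))
    (sG₀-resp (≈-sym (tails-agree cp₂)) (tails-agree cp₁) (sG₀-sym e))

  contradiction : ⊥
  contradiction = G₀-target-nonzero (B₀-elim (reflect _ _ reversed-edge)) (λ _ → refl)

proposition7p4 : ¬ (B₀ ⊑c GsG₀)
proposition7p4 (f , continuous , injective , reduces) =
  Reduction.contradiction f continuous injective
    (λ x y → proj₁ (reduces x y)) (λ x y → proj₂ (reduces x y))
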